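{- Let $G=(V,E)$ be a connected non-trivial triangle-free graph, $t\ge 2$ an integer, $x,y,z\in V$ with $x\ne y$, and let $w=z^{j-1}xx_{j+1}\cdots x_t\in V^t$ and $w'=z^{j-1}yy_{j+1}\cdots y_t\in V^t$ with $1\le j\le t-1$. Then $$d_{S(G,t)}(w,w')=\min\{\vartheta(x,y),\vartheta'(x,y)\},$$ where $$\vartheta(x,y)=\lambda(x,y)+(2^{t-j+1}-1)\,d_G(x,y)-2(2^{t-j}-1),\qquad \vartheta'(x,y)=\lambda'(x,y)+(2^{t-j+1}-1)\,d_G(x,y)+1,$$ $$\lambda(x,y)=\min_{P_i\in\mathcal{P}(x,y)}\left\{d_{S(G,t-j)}\left(\left(x^{(i)}\right)^{t-j},x_{j+1}\cdots x_t\right)+d_{S(G,t-j)}\left(\left(y^{(i)}\right)^{t-j},y_{j+1}\cdots y_t\right)\right\},$$ $$\lambda'(x,y)=\min_{P_k\in\mathcal{P}'(x,y)}\left\{d_{S(G,t-j)}\left(\left(x^{(k)}\right)^{t-j},x_{j+1}\cdots x_t\right)+d_{S(G,t-j)}\left(\left(y^{(k)}\right)^{t-j},y_{j+1}\cdots y_t\right)\right\}.$$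
   Context: For a graph $G=(V,E)$ and a positive integer $t$, $V^t$ denotes the set of words of length $t$ over the alphabet $V$; concatenation of words is written by juxtaposition, and $x^k$ denotes the word consisting of $k$ copies of the letter $x$. The generalized Sierpiński graph $S(G,t)$ has vertex set $V^t$ and edge set $\{\{w u_i u_j^{d-1}, w u_j u_i^{d-1}\} : \{u_i,u_j\}\in E,\ d\in\{1,\dots,t\},\ w\in V^{t-d}\}$. $d_H$ denotes the shortest-path distance in a graph $H$. For $x,y\in V$, $\mathcal{P}(x,y)$ is the set of all shortest paths in $G$ between $x$ and $y$, and $\mathcal{P}'(x,y)$ is the set of all paths in $G$ between $x$ and $y$ of length $d_G(x,y)+1$. For a path $P$ in either set (indexed $P_i$ or $P_k$), $x^{(i)}$, $y^{(i)}$ (resp. $x^{(k)}$, $y^{(k)}$) denote the neighbours of $x$ and of $y$ lying on that path. A minimum over an empty set is $+\infty$. -}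

module Defs where

open import Data.Nat using (ℕ; zero; suc; _+_; _*_; _∸_; _^_; _≤_; _<_; s≤s; z≤n)
open import Data.Nat.Properties using (+-suc; m+[n∸m]≡n; ≤-trans)
open import Data.Integer as ℤ using (ℤ; +_)
open import Data.Fin using (Fin; zero; suc; fromℕ; inject₁)
open import Data.Vec using (Vec; _∷_; []; replicate; _++_)
open import Data.Product using (Σ; _×_; _,_; ∃)
open import Data.Empty using (⊥)
open import Relation.Nullary using (¬_)
open import Relation.Binary.PropositionalEquality using (_≡_; refl; subst; trans; cong)

record Graph : Set₁ where
  field
    n      : ℕ
    Adj    : Fin n → Fin n → Set
    adj-sym : ∀ {a b} → Adj a b → Adj b a
    irrefl : ∀ {a} → ¬ Adj a a

data Walk {A : Set} (R : A → A → Set) : A → A → ℕ → Set where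
  nil  : ∀ {a} → Walk R a a 0
  cons : ∀ {a c b k} → R a c → Walk R c b k → Walk R a b (suc k)

Dist : {A : Set} → (A → A → Set) → A → A → ℕ → Set
Dist R a b d = Walk R a b d × (∀ k → Walk R a b k → d ≤ k)

Connected : Graph → Set
Connected G = ∀ a b → ∃ λ k → Walk (Graph.Adj G) a b k

NonTrivial : Graph → Set
NonTrivial G = 2 ≤ Graph.n G

TriangleFree : Graph → Set
TriangleFree G = ∀ a b c → ¬ (Graph.Adj G a b × Graph.Adj G b c × Graph.Adj G a c)

IsPath : (G : Graph) {m : ℕ} → (Fin (suc (suc m)) → Fin (Graph.n G)) →
         Fin (Graph.n G) → Fin (Graph.n G) → Set
IsPath G {m} p x y =
  p zero ≡ x × p (fromℕ (suc m)) ≡ y ×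
  (∀ (i : Fin (suc m)) → Graph.Adj G (p (inject₁ i)) (p (suc i))) ×
  (∀ i k → p i ≡ p k → i ≡ k)

nbrFirst : ∀ {V : Set} {m} → (Fin (suc (suc m)) → V) → V
nbrFirst p = p (suc zero)

nbrLast : ∀ {V : Set} {m} → (Fin (suc (suc m)) → V) → V
nbrLast {m = m} p = p (inject₁ (fromℕ m))

-- Generalized Sierpinski graph S(G,t) on words Vec V t:
-- {w a b^(d-1), w b a^(d-1)} for {a,b} ∈ E, 1 ≤ d ≤ t, w ∈ V^(t-d);
-- here k = t - d and l = d - 1.

SAdj : (G : Graph) (t : ℕ) → Vec (Fin (Graph.n G)) t → Vec (Fin (Graph.n G)) t → Set
SAdj G t u v =
  Σ ℕ λ k → Σ ℕ λ l → Σ (k + suc l ≡ t) λ eq →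
  Σ (Vec (Fin (Graph.n G)) k) λ w → Σ (Fin (Graph.n G)) λ a → Σ (Fin (Graph.n G)) λ b →
    Graph.Adj G a b ×
    u ≡ subst (Vec (Fin (Graph.n G))) eq (w ++ (a ∷ replicate l b)) ×
    v ≡ subst (Vec (Fin (Graph.n G))) eq (w ++ (b ∷ replicate l a))

data ℤ∞ : Set where
  fin : ℤ → ℤ∞
  ∞   : ℤ∞

_⊕_ : ℤ∞ → ℤ → ℤ∞
fin a ⊕ b = fin (a ℤ.+ b)
∞ ⊕ b = ∞

min∞ : ℤ∞ → ℤ∞ → ℤ∞
min∞ (fin a) (fin b) = fin (a ℤ.⊓ b)
min∞ (fin a) ∞ = fin a
min∞ ∞ b = b

IsMin : (ℤ → Set) → ℤ∞ → Set
IsMin S (fin m) = S m × (∀ v → S v → m ℤ.≤ v)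
IsMin S ∞ = ∀ v → ¬ S v

-- The sets whose minima are λ(x,y) (len = d_G(x,y)) and λ'(x,y)
-- (len = d_G(x,y)+1): values
--   d_{S(G,s)}((x^(i))^s, xs) + d_{S(G,s)}((y^(i))^s, ys)
-- over paths P_i from x to y of length len.

LamSet : (G : Graph) (s : ℕ) (x y : Fin (Graph.n G))
         (xs ys : Vec (Fin (Graph.n G)) s) (len : ℕ) → ℤ → Set
LamSet G s x y xs ys len v =
  Σ ℕ λ m → Σ (Fin (suc (suc m)) → Fin (Graph.n G)) λ p →
    IsPath G p x y × suc m ≡ len ×
    Σ ℕ λ d₁ → Σ ℕ λ d₂ →
      Dist (SAdj G s) (replicate s (nbrFirst p)) xs d₁ ×
      Dist (SAdj G s) (replicate s (nbrLast p)) ys d₂ ×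
      v ≡ + (d₁ + d₂)

lenEq : ∀ {t j} → 1 ≤ j → j ≤ t → (j ∸ 1) + suc (t ∸ j) ≡ t
lenEq {suc t} {suc j} (s≤s z≤n) (s≤s h) = trans (+-suc j (t ∸ j)) (cong suc (m+[n∸m]≡n h))

module Submission where

-- Let s = t − j, κ s = 2^s − 1 and cross s = 2^(s+1) − 1.  The common prefix does not
-- change distances (dist-drop-prefix), so we work in S(G,s+1): copies a V^s, a ∈ V,
-- joined by bridge edges {a b^s, b a^s}.  Read copy by copy (CopyWalk), a shortest
-- walk from x xs to y ys never returns straight to the copy it came from, so it
-- follows a Route: a leg inside copy x, a walk x next ⋯ y of G whose intermediate
-- copies each cost at least 2 κ s + 1 (extreme-far, which needs triangle-freeness),
-- and a leg inside copy y.  Conversely every route, in particular one built from a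
-- path P_i, gives a walk (upper-bound).  A route with at most d_G(x,y)+1 hops runs
-- along a path of length d_G(x,y) or d_G(x,y)+1 and yields an element of the λ- or
-- λ'-set; a longer one is beaten by a shortest path (lower-bound).  Hence D is the
-- minimum of the two shifted sets (shifted-minimum).  Adjacency is only classically
-- decidable and distances only classically exist; as the conclusion is a decidable
-- equation, the argument runs in the double-negation monad.

open import Defs
open import Data.Nat as ℕ using (ℕ; zero; suc; _∸_; _*_; _^_; _≤_; _<_; _+_; s≤s; z≤n; _≤?_)
open import Data.Nat.Properties hiding (_≟_)
open import Data.Nat.Induction using (<-rec)
open import Data.Nat.Tactic.RingSolver using (solve-∀)
open import Data.Integer as ℤ using (ℤ; +_; _-_; +≤+)
import Data.Integer.Properties as ℤ
open import Data.Fin using (Fin; zero; suc; toℕ; fromℕ; inject₁; _≟_)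
open import Data.Fin.Properties using (toℕ-injective; toℕ≤pred[n]; toℕ-inject₁; sequence)
open import Data.Vec using (Vec; _∷_; []; replicate; _++_)
open import Data.Product using (Σ; _×_; _,_)
open import Data.Sum using (_⊎_; inj₁; inj₂)
open import Data.Unit using (⊤; tt)
open import Data.Empty using (⊥-elim)
open import Effect.Monad using (RawMonad)
open import Level using (0ℓ)
open import Relation.Nullary using (¬_; Dec; yes; no)
open import Relation.Nullary.Decidable using (¬¬-excluded-middle; decidable-stable)
open import Relation.Nullary.Negation using (¬¬-Monad)
open import Relation.Binary using (tri<; tri≈; tri>)
open import Relation.Binary.PropositionalEquality

open RawMonad (¬¬-Monad {a = 0ℓ}) using (pure; _>>=_; rawApplicative)

¬¬-decidable : ∀ {n} (R : Fin n → Fin n → Set) → ¬ ¬ (∀ a b → Dec (R a b))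
¬¬-decidable R = sequence rawApplicative λ a → sequence rawApplicative λ b → ¬¬-excluded-middle

Least : (ℕ → Set) → Set
Least P = Σ ℕ λ d → P d × (∀ k → P k → d ≤ k)

¬¬-least : (P : ℕ → Set) → ∀ k → P k → ¬ ¬ Least P
¬¬-least P = <-rec (λ k → P k → ¬ ¬ Least P) search
  where
  search : ∀ k → (∀ {k'} → k' < k → P k' → ¬ ¬ Least P) → P k → ¬ ¬ Least P
  search k below pk = ¬¬-excluded-middle {A = Σ ℕ λ k' → k' < k × P k'} >>= λ where
    (yes (k' , k'<k , pk')) → below k'<k pk'
    (no none) → pure (k , pk , λ k' pk' → ≮⇒≥ λ k'<k → none (k' , k'<k , pk'))

¬¬-distance : ∀ {A : Set} {R : A → A → Set} {a b k} → Walk R a b k →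
              ¬ ¬ (Σ ℕ λ d → Dist R a b d × d ≤ k)
¬¬-distance {R = R} {a} {b} {k} w =
  ¬¬-least (Walk R a b) k w >>= λ (d , shortest , minimal) → pure (d , (shortest , minimal) , minimal k w)

module _ {A : Set} {R : A → A → Set} where

  infixr 5 _++ʷ_

  _++ʷ_ : ∀ {a b c k l} → Walk R a b k → Walk R b c l → Walk R a c (k + l)
  nil      ++ʷ w = w
  cons e v ++ʷ w = cons e (v ++ʷ w)

  reverseʷ : (∀ {a b} → R a b → R b a) → ∀ {a b k} → Walk R a b k → Walk R b a k
  reverseʷ R-sym nil = nil
  reverseʷ R-sym {k = suc k} (cons e w) =
    subst (Walk R _ _) (+-comm k 1) (reverseʷ R-sym w ++ʷ cons (R-sym e) nil)

  vertexAt : ∀ {a b m} → Walk R a b m → Fin (suc m) → A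
  vertexAt {a = a} w          zero    = a
  vertexAt         (cons e w) (suc i) = vertexAt w i

  vertexAt-last : ∀ {a b m} (w : Walk R a b m) → vertexAt w (fromℕ m) ≡ b
  vertexAt-last nil        = refl
  vertexAt-last (cons e w) = vertexAt-last w

  vertexAt-step : ∀ {a b m} (w : Walk R a b m) (i j : Fin (suc m)) → toℕ j ≡ suc (toℕ i) →
                  R (vertexAt w i) (vertexAt w j)
  vertexAt-step nil        zero    zero          ()
  vertexAt-step (cons e w) zero    (suc zero)    _  = e
  vertexAt-step (cons e w) zero    (suc (suc j)) ()
  vertexAt-step (cons e w) (suc i) (suc j)       eq = vertexAt-step w i j (suc-injective eq)

  dropʷ : ∀ {a b m} (w : Walk R a b m) (j : Fin (suc m)) → Walk R (vertexAt w j) b (m ∸ toℕ j)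
  dropʷ w          zero    = w
  dropʷ (cons e w) (suc j) = dropʷ w j

  shortcut : ∀ {a b m} (w : Walk R a b m) (i j : Fin (suc m)) → toℕ i < toℕ j →
             vertexAt w i ≡ vertexAt w j → Σ ℕ λ m' → Walk R a b m' × m' + (toℕ j ∸ toℕ i) ≡ m
  shortcut {m = m} w zero j _ same =
    m ∸ toℕ j , subst (λ v → Walk R v _ _) (sym same) (dropʷ w j) , m∸n+n≡m (toℕ≤pred[n] j)
  shortcut (cons e w) (suc i) (suc j) (s≤s i<j) same with shortcut w i j i<j same
  ... | m' , w' , len = suc m' , cons e w' , cong suc len

  -- In a walk at most one step longer than the distance d, a vertex can only
  -- repeat in consecutive positions (a longer closed sub-walk could be cut out).
  repeat-consecutive : ∀ {a b m} (w : Walk R a b m) d → (∀ k → Walk R a b k → d ≤ k) → m ≤ suc d →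
                       ∀ i j → toℕ i < toℕ j → vertexAt w i ≡ vertexAt w j → toℕ j ≡ suc (toℕ i)
  repeat-consecutive {m = m} w d minimal m≤1+d i j i<j same = consecutive (shortcut w i j i<j same)
    where
    consecutive : (Σ ℕ λ m' → Walk R _ _ m' × m' + (toℕ j ∸ toℕ i) ≡ m) → toℕ j ≡ suc (toℕ i)
    consecutive (m' , w' , len) = begin
      toℕ j                   ≡⟨ m+[n∸m]≡n (<⇒≤ i<j) ⟨
      toℕ i + (toℕ j ∸ toℕ i) ≡⟨ cong (λ g → toℕ i + g) gap≡1 ⟩
      toℕ i + 1               ≡⟨ +-comm (toℕ i) 1 ⟩
      suc (toℕ i)             ∎
      where
      open ≡-Reasoning
      m≤m'+1 : m' + (toℕ j ∸ toℕ i) ≤ m' + 1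
      m≤m'+1 = ≤-trans (≤-reflexive len)
                 (≤-trans m≤1+d (≤-trans (s≤s (minimal m' w')) (≤-reflexive (+-comm 1 m'))))
      gap≡1 : toℕ j ∸ toℕ i ≡ 1
      gap≡1 = ≤-antisym (+-cancelˡ-≤ m' _ 1 m≤m'+1) (m<n⇒0<n∸m i<j)

  near-geodesic-injective : (∀ {v} → ¬ R v v) → ∀ {a b m} (w : Walk R a b m) d →
                            (∀ k → Walk R a b k → d ≤ k) → m ≤ suc d →
                            ∀ i j → vertexAt w i ≡ vertexAt w j → i ≡ j
  near-geodesic-injective irreflexive w d minimal m≤1+d i j same with <-cmp (toℕ i) (toℕ j)
  ... | tri≈ _ i≡j _ = toℕ-injective i≡j
  ... | tri< i<j _ _ = ⊥-elim (irreflexive (subst (R (vertexAt w i)) (sym same)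
                         (vertexAt-step w i j (repeat-consecutive w d minimal m≤1+d i j i<j same))))
  ... | tri> _ _ j<i = ⊥-elim (irreflexive (subst (R (vertexAt w j)) same
                         (vertexAt-step w j i (repeat-consecutive w d minimal m≤1+d j i j<i (sym same)))))

  penultimate : ∀ {c b m} → A → Walk R c b m → A
  penultimate p nil                = p
  penultimate p (cons {a = c} _ w) = penultimate c w

  penultimate-step : ∀ {p c b m} → R p c → (w : Walk R c b m) → R (penultimate p w) b
  penultimate-step e nil         = e
  penultimate-step _ (cons e' w) = penultimate-step e' w

  vertexAt-penultimate : ∀ {p c b m} (e : R p c) (w : Walk R c b m) →
                         vertexAt (cons e w) (inject₁ (fromℕ m)) ≡ penultimate p w
  vertexAt-penultimate e nil         = refl
  vertexAt-penultimate _ (cons e' w) = vertexAt-penultimate e' w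

  tabulateʷ : ∀ m (p : Fin (suc m) → A) → (∀ (i : Fin m) → R (p (inject₁ i)) (p (suc i))) →
              Walk R (p zero) (p (fromℕ m)) m
  tabulateʷ zero    p steps = nil
  tabulateʷ (suc m) p steps = cons (steps zero) (tabulateʷ m (λ i → p (suc i)) (λ i → steps (suc i)))

  penultimate-tabulateʷ : ∀ m (p : Fin (suc (suc m)) → A) steps →
                          penultimate (p zero) (tabulateʷ m (λ i → p (suc i)) steps) ≡ p (inject₁ (fromℕ m))
  penultimate-tabulateʷ zero    p steps = refl
  penultimate-tabulateʷ (suc m) p steps = penultimate-tabulateʷ m (λ i → p (suc i)) (λ i → steps (suc i))

mapʷ : ∀ {A B : Set} {R : A → A → Set} {Q : B → B → Set} (f : A → B) →
       (∀ {a b} → R a b → Q (f a) (f b)) → ∀ {a b k} → Walk R a b k → Walk Q (f a) (f b) k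
mapʷ f preserve nil        = nil
mapʷ f preserve (cons e w) = cons (preserve e) (mapʷ f preserve w)

-- κ k = 2^k − 1: the length of a walk in S(G,k) between the extreme vertices p^k
-- and q^k of adjacent p, q, and a lower bound for d(p^k, q^k) whenever p ≠ q.
κ : ℕ → ℕ
κ zero    = 0
κ (suc k) = κ k + suc (κ k)

-- cross k = 2^(k+1) − 1: the cost of passing through a copy of S(G,k) inside S(G,k+1)
-- from one extreme vertex to another one at distance 2.
cross : ℕ → ℕ
cross k = suc (κ k + κ k)

-- One more intermediate copy in a tail costs 2 κ k + 1 = cross k:
-- (2 κ k) + 1 + (ℓ + m · cross k) = ℓ + (m + 1) · cross k.
tail-hop-length : ∀ K ℓ X → (K + K) + suc (ℓ + X) ≡ ℓ + (suc (K + K) + X)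
tail-hop-length = solve-∀

module Sierpinski (G : Graph) where
  open Graph G

  V : Set
  V = Fin n

  S : (k : ℕ) → Vec V k → Vec V k → Set
  S = SAdj G

  liftEdge : ∀ {k} a {u v : Vec V k} → S k u v → S (suc k) (a ∷ u) (a ∷ v)
  liftEdge a (k' , l , refl , w , p , q , e , refl , refl) = suc k' , l , refl , a ∷ w , p , q , e , refl , refl

  liftʷ : ∀ {k} a {u v : Vec V k} {l} → Walk (S k) u v l → Walk (S (suc k)) (a ∷ u) (a ∷ v) l
  liftʷ a = mapʷ (a ∷_) (liftEdge a)

  bridge : ∀ {k a b} → Adj a b → S (suc k) (a ∷ replicate k b) (b ∷ replicate k a)
  bridge {k} {a} {b} e = 0 , k , refl , [] , a , b , e , refl , refl

  edge-cases : ∀ {k a b} {u v : Vec V k} → S (suc k) (a ∷ u) (b ∷ v) →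
               (a ≡ b × S k u v) ⊎ (Adj a b × u ≡ replicate k b × v ≡ replicate k a)
  edge-cases (zero   , l , refl , []    , p , q , e , refl , refl) = inj₂ (e , refl , refl)
  edge-cases (suc k' , l , refl , _ ∷ w , p , q , e , refl , refl) = inj₁ (refl , k' , l , refl , w , p , q , e , refl , refl)

  S-sym : ∀ {k} {u v : Vec V k} → S k u v → S k v u
  S-sym (k' , l , refl , w , p , q , e , refl , refl) = k' , l , refl , w , q , p , adj-sym e , refl , refl

  module _ {k : ℕ} where

    -- A walk of S(G,k+1) from a u to b v, described copy by copy: either it stays in
    -- copy a, or it walks inside copy a to a c^k, crosses the bridge to c a^k and
    -- continues from there.
    data CopyWalk : V → Vec V k → V → Vec V k → ℕ → Set where
      stay : ∀ {a u v l} → Walk (S k) u v l → CopyWalk a u a v l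
      hop  : ∀ {a c b u v l L} → Walk (S k) u (replicate k c) l → Adj a c →
             CopyWalk c (replicate k a) b v L → CopyWalk a u b v (l + suc L)

    prependEdge : ∀ {a b u u' v L} → S k u u' → CopyWalk a u' b v L → CopyWalk a u b v (suc L)
    prependEdge e (stay w)     = stay (cons e w)
    prependEdge e (hop w ac r) = hop (cons e w) ac r

    prependWalk : ∀ {a c b u v l L} → Walk (S k) u (replicate k c) l →
                  CopyWalk a (replicate k c) b v L → CopyWalk a u b v (l + L)
    prependWalk w (stay w') = stay (w ++ʷ w')
    prependWalk {l = l} w (hop {l = l'} {L = L} w' ac r) =
      subst (CopyWalk _ _ _ _) (+-assoc l l' (suc L)) (hop (w ++ʷ w') ac r)

  toCopyWalk : ∀ {k a b u v L} → Walk (S (suc k)) (a ∷ u) (b ∷ v) L → CopyWalk {k} a u b v L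
  toCopyWalk nil = stay nil
  toCopyWalk (cons {c = _ ∷ _} e w) with edge-cases e
  ... | inj₁ (refl , e')        = prependEdge e' (toCopyWalk w)
  ... | inj₂ (ac , refl , refl) = hop nil ac (toCopyWalk w)

  fromCopyWalk : ∀ {k a b u v L} → CopyWalk {k} a u b v L → Walk (S (suc k)) (a ∷ u) (b ∷ v) L
  fromCopyWalk {a = a} (stay w)     = liftʷ a w
  fromCopyWalk {a = a} (hop w ac r) = liftʷ a w ++ʷ cons (bridge ac) (fromCopyWalk r)

  extremeWalk : ∀ k {p q} → Adj p q → Walk (S k) (replicate k p) (replicate k q) (κ k)
  extremeWalk zero    e = nil
  extremeWalk (suc k) {p} {q} e = liftʷ p (extremeWalk k e) ++ʷ cons (bridge e) (liftʷ q (extremeWalk k e))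

  extremeWalk₂ : ∀ k {p r q} → Adj p r → Adj r q → Walk (S k) (replicate k p) (replicate k q) (κ k + κ k)
  extremeWalk₂ k e f = extremeWalk k e ++ʷ extremeWalk k f

  -- A tail from copy c, entered at c p^k: the copies visited form a walk c ⋯ y of G,
  -- each intermediate copy is crossed between extreme vertices, and a last leg goes
  -- inside copy y from y r^k (r the copy it is entered from) to y ys.
  record Tail (k : ℕ) (p c y : V) (ys : Vec V k) : Set where
    constructor tail
    field
      hops  : ℕ
      trail : Walk Adj c y hops
      ℓ     : ℕ
      leg   : Walk (S k) (replicate k (penultimate p trail)) ys ℓ

  tailLength : ∀ {k p c y ys} → Tail k p c y ys → ℕ
  tailLength {k} (tail hops _ ℓ _) = ℓ + hops * cross k

  -- A route from x xs to y ys: a leg inside copy x to x next^k, the bridge to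
  -- next x^k, and a tail from there.
  record Route (k : ℕ) (x : V) (xs : Vec V k) (y : V) (ys : Vec V k) : Set where
    constructor route
    field
      next  : V
      step  : Adj x next
      ℓ₁    : ℕ
      leg₁  : Walk (S k) xs (replicate k next) ℓ₁
      rest  : Tail k x next y ys

  routeLength : ∀ {k x xs y ys} → Route k x xs y ys → ℕ
  routeLength (route _ _ ℓ₁ _ rest) = ℓ₁ + suc (tailLength rest)

  -- Every tail is realised by a copy walk of its length: each intermediate copy c,
  -- entered at c p^k and left at c c'^k, is crossed by a walk of length 2 κ k.
  tail→copyWalk : ∀ {k p c y ys} → Adj p c → (T : Tail k p c y ys) →
                  CopyWalk {k} c (replicate k p) y ys (tailLength T)
  tail→copyWalk _ (tail zero nil ℓ leg) = subst (CopyWalk _ _ _ _) (sym (+-identityʳ ℓ)) (stay leg)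
  tail→copyWalk {k} pc (tail (suc m) (cons cc' trail) ℓ leg) =
    subst (CopyWalk _ _ _ _) (tail-hop-length (κ k) ℓ (m * cross k))
      (hop (extremeWalk₂ k pc cc') cc' (tail→copyWalk cc' (tail m trail ℓ leg)))

  route→walk : ∀ {k x xs y ys} (r : Route k x xs y ys) → Walk (S (suc k)) (x ∷ xs) (y ∷ ys) (routeLength r)
  route→walk (route _ step _ leg₁ rest) = fromCopyWalk (hop leg₁ step (tail→copyWalk step rest))

  pathWalk : ∀ {k m x y xs ys d₁ d₂} (p : Fin (suc (suc m)) → V) → IsPath G p x y →
             Walk (S k) (replicate k (nbrFirst p)) xs d₁ → Walk (S k) (replicate k (nbrLast p)) ys d₂ →
             Walk (S (suc k)) (x ∷ xs) (y ∷ ys) (d₁ + suc (d₂ + m * cross k))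
  pathWalk {k} {m} {d₂ = d₂} p (refl , refl , steps , _) w₁ w₂ =
    route→walk (route (nbrFirst p) (steps zero) _ (reverseʷ S-sym w₁)
      (tail m trail d₂ (subst (λ r → Walk (S k) (replicate k r) _ d₂) (sym (penultimate-tabulateʷ m p inner)) w₂)))
    where
    inner : ∀ (i : Fin m) → Adj (p (suc (inject₁ i))) (p (suc (suc i)))
    inner i = steps (suc i)
    trail : Walk Adj (p (suc zero)) (p (fromℕ (suc m))) m
    trail = tabulateʷ m (λ i → p (suc i)) inner

  upper-bound : ∀ {k x y xs ys D} → Dist (S (suc k)) (x ∷ xs) (y ∷ ys) D →
                ∀ m v → LamSet G k x y xs ys (suc m) v → + D ℤ.≤ v ℤ.+ + suc (m * cross k)
  upper-bound {k} {D = D} (_ , minimal) m _ (_ , p , isPath , len , d₁ , d₂ , (w₁ , _) , (w₂ , _) , refl)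
    with suc-injective len
  ... | refl = +≤+ (subst (D ≤_) (rearrange d₁ d₂ (m * cross k)) (minimal _ (pathWalk p isPath w₁ w₂)))
    where
    rearrange : ∀ d₁ d₂ X → d₁ + suc (d₂ + X) ≡ d₁ + d₂ + suc X
    rearrange = solve-∀

  module _ {k : ℕ} where

    LeavesAvoiding : ∀ {a u b v L} → V → CopyWalk {k} a u b v L → Set
    LeavesAvoiding p (stay _)            = ⊤
    LeavesAvoiding p (hop {c = c} _ _ _) = c ≢ p

    NonBacktracking : ∀ {a u b v L} → CopyWalk {k} a u b v L → Set
    NonBacktracking (stay _)            = ⊤
    NonBacktracking (hop {a = a} _ _ r) = LeavesAvoiding a r × NonBacktracking r

    -- A copy walk that goes from copy a to c and straight back to a can skip the
    -- visit to c (it re-enters a at the vertex a c^k where it left), so every copy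
    -- walk is non-backtracking or has a strictly shorter replacement.
    nonBacktracking-or-shorter : ∀ {a u b v L} (cw : CopyWalk {k} a u b v L) →
                                 NonBacktracking cw ⊎ Σ ℕ λ L' → L' < L × CopyWalk {k} a u b v L'
    nonBacktracking-or-shorter (stay w) = inj₁ tt
    nonBacktracking-or-shorter (hop {l = l} w ac r) with nonBacktracking-or-shorter r
    ... | inj₂ (L' , L'<L , r') = inj₂ (l + suc L' , +-monoʳ-< l (s≤s L'<L) , hop w ac r')
    nonBacktracking-or-shorter (hop w ac (stay _)) | inj₁ nb = inj₁ (tt , nb)
    nonBacktracking-or-shorter (hop {a = a} {l = l} w ac (hop {c = c'} {l = l'} {L = L} w' cc' r)) | inj₁ nb
      with c' ≟ a
    ... | yes refl = inj₂ (l + L , +-monoʳ-< l (s≤s (≤-trans (n≤1+n L) (m≤n+m (suc L) l'))) , prependWalk w r)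
    ... | no c'≢a  = inj₁ (c'≢a , nb)

  walkPath : ∀ {x a y m d} (e : Adj x a) (w : Walk Adj a y m) → (∀ k → Walk Adj x y k → d ≤ k) →
             suc m ≤ suc d → IsPath G (vertexAt (cons e w)) x y
  walkPath e w minimal m≤1+d =
    refl , vertexAt-last (cons e w) ,
    (λ i → vertexAt-step (cons e w) (inject₁ i) (suc i) (cong suc (sym (toℕ-inject₁ i)))) ,
    near-geodesic-injective irrefl (cons e w) _ minimal m≤1+d

  ¬¬-lamElement : ∀ {k m x y xs ys l₁ l₂ len} (p : Fin (suc (suc m)) → V) → IsPath G p x y → suc m ≡ len →
                  Walk (S k) (replicate k (nbrFirst p)) xs l₁ → Walk (S k) (replicate k (nbrLast p)) ys l₂ →
                  ¬ ¬ (Σ ℕ λ v → LamSet G k x y xs ys len (+ v) × v ≤ l₁ + l₂)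
  ¬¬-lamElement p isPath len w₁ w₂ =
    ¬¬-distance w₁ >>= λ (d₁ , dist₁ , d₁≤l₁) →
    ¬¬-distance w₂ >>= λ (d₂ , dist₂ , d₂≤l₂) →
    pure (d₁ + d₂ , (_ , p , isPath , len , d₁ , d₂ , dist₁ , dist₂ , refl) , +-mono-≤ d₁≤l₁ d₂≤l₂)

  Attained : ∀ {k} → V → V → Vec V k → Vec V k → ℕ → ℕ → Set
  Attained {k} x y xs ys d' D =
    (Σ ℤ λ v → LamSet G k x y xs ys (suc d') v × v ℤ.+ + suc (d' * cross k) ℤ.≤ + D) ⊎
    (Σ ℤ λ v → LamSet G k x y xs ys (suc d' + 1) v × v ℤ.+ + suc ((d' + 1) * cross k) ℤ.≤ + D)

  module Bounds (dec : ∀ a b → Dec (Adj a b)) (triangle-free : TriangleFree G) where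

    adjacent-distinct : ∀ {a b} → Adj a b → a ≢ b
    adjacent-distinct ab refl = irrefl ab

    dist₂ : V → V → ℕ
    dist₂ q v with v ≟ q | dec v q
    ... | yes _ | _     = 0
    ... | no _  | yes _ = 1
    ... | no _  | no _  = 2

    dist₂≤2 : ∀ q v → dist₂ q v ≤ 2
    dist₂≤2 q v with v ≟ q | dec v q
    ... | yes _ | _     = z≤n
    ... | no _  | yes _ = s≤s z≤n
    ... | no _  | no _  = ≤-refl

    dist₂-self : ∀ q → dist₂ q q ≡ 0
    dist₂-self q with q ≟ q
    ... | yes _   = refl
    ... | no q≢q = ⊥-elim (q≢q refl)

    dist₂-adjacent : ∀ {q v} → Adj v q → dist₂ q v ≡ 1
    dist₂-adjacent {q} {v} vq with v ≟ q | dec v q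
    ... | yes refl | _      = ⊥-elim (irrefl vq)
    ... | no _     | yes _  = refl
    ... | no _     | no ¬vq = ⊥-elim (¬vq vq)

    dist₂-positive : ∀ {q v} → v ≢ q → 1 ≤ dist₂ q v
    dist₂-positive {q} {v} v≢q with v ≟ q | dec v q
    ... | yes v≡q | _     = ⊥-elim (v≢q v≡q)
    ... | no _    | yes _ = s≤s z≤n
    ... | no _    | no _  = s≤s z≤n

    dist₂-far : ∀ {q v} → v ≢ q → ¬ Adj v q → dist₂ q v ≡ 2
    dist₂-far {q} {v} v≢q ¬vq with v ≟ q | dec v q
    ... | yes v≡q | _      = ⊥-elim (v≢q v≡q)
    ... | no _    | yes vq = ⊥-elim (¬vq vq)
    ... | no _    | no _   = refl

    dist₂-step : ∀ {q e g} → Adj e g → dist₂ q e ≤ suc (dist₂ q g)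
    dist₂-step {q} {e} {g} eg = by-cases (g ≟ q)
      where
      by-cases : Dec (g ≡ q) → dist₂ q e ≤ suc (dist₂ q g)
      by-cases (yes refl) = subst (_≤ _) (sym (dist₂-adjacent eg)) (s≤s z≤n)
      by-cases (no g≢q)   = ≤-trans (dist₂≤2 q e) (s≤s (dist₂-positive g≢q))

    mutual
      copyWalk-to-extreme : ∀ k {e r q L} → CopyWalk {k} e (replicate k r) q (replicate k q) L → Adj r e →
                            κ k * (dist₂ q r + dist₂ q e) + dist₂ q e ≤ L
      copyWalk-to-extreme k {r = r} {q} (stay w) rq rewrite dist₂-adjacent {q} {r} rq | dist₂-self q =
        subst (_≤ _) (sym (trivial (κ k))) (extreme-apart k (adjacent-distinct rq) w)
        where
        trivial : ∀ K → K * (1 + 0) + 0 ≡ K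
        trivial = solve-∀
      copyWalk-to-extreme k {e} {r} {q} (hop {c = g} w eg rest) re with g ≟ r
      ... | yes refl = back (κ k) (dist₂ q g) (dist₂ q e) _ _ (dist₂-step eg) (copyWalk-to-extreme k rest eg)
        where
        -- the walk returns to copy r at once
        back : ∀ K A E L l → E ≤ suc A → K * (E + A) + A ≤ L → K * (A + E) + E ≤ l + suc L
        back K A E L l E≤1+A bound = begin
          K * (A + E) + E       ≡⟨ cong (λ s → K * s + E) (+-comm A E) ⟩
          K * (E + A) + E       ≤⟨ +-monoʳ-≤ (K * (E + A)) E≤1+A ⟩
          K * (E + A) + suc A   ≡⟨ +-suc (K * (E + A)) A ⟩
          suc (K * (E + A) + A) ≤⟨ s≤s bound ⟩
          suc L                 ≤⟨ m≤n+m (suc L) l ⟩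
          l + suc L             ∎
          where open ≤-Reasoning
      ... | no g≢r =
        forward (κ k) (dist₂ q r) (dist₂ q e) (dist₂ q g) _ _ (dist₂≤2 q r) (dist₂-step eg)
          (extreme-far k (λ r≡g → g≢r (sym r≡g)) (λ rg → triangle-free r e g (re , eg , rg)) w)
          (copyWalk-to-extreme k rest eg)
        where
        -- the walk crosses copy e from r to a letter g ≠ r, at cost 2 κ k since r e g is no triangle
        forward : ∀ K A E Γ L l → A ≤ 2 → E ≤ suc Γ → K + K ≤ l → K * (E + Γ) + Γ ≤ L →
                  K * (A + E) + E ≤ l + suc L
        forward K A E Γ L l A≤2 E≤1+Γ crossing bound = begin
          K * (A + E) + E                     ≤⟨ +-mono-≤ (*-monoʳ-≤ K (+-monoˡ-≤ E A≤2+Γ)) E≤1+Γ ⟩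
          K * (2 + Γ + E) + (1 + Γ)           ≡⟨ regroup K Γ E ⟩
          (K + K) + (1 + (K * (E + Γ) + Γ))   ≤⟨ +-mono-≤ crossing (s≤s bound) ⟩
          l + suc L                           ∎
          where
          open ≤-Reasoning
          A≤2+Γ : A ≤ 2 + Γ
          A≤2+Γ = ≤-trans A≤2 (m≤m+n 2 Γ)
          regroup : ∀ K Γ E → K * (2 + Γ + E) + (1 + Γ) ≡ (K + K) + (1 + (K * (E + Γ) + Γ))
          regroup = solve-∀

      extreme-apart : ∀ k {p q L} → p ≢ q → Walk (S k) (replicate k p) (replicate k q) L → κ k ≤ L
      extreme-apart zero    _   _ = z≤n
      extreme-apart (suc k) p≢q w with toCopyWalk w
      ... | stay _ = ⊥-elim (p≢q refl)
      ... | hop w' pc rest =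
        +-mono-≤ (extreme-apart k (adjacent-distinct pc) w')
                 (s≤s (≤-trans (κ≤ (dist₂-positive p≢q)) (copyWalk-to-extreme k rest pc)))
        where
        κ≤ : ∀ {A E} → 1 ≤ A → κ k ≤ κ k * (A + E) + E
        κ≤ {A} {E} 1≤A = begin
          κ k                  ≡⟨ *-identityʳ (κ k) ⟨
          κ k * 1              ≤⟨ *-monoʳ-≤ (κ k) (≤-trans 1≤A (m≤m+n A E)) ⟩
          κ k * (A + E)        ≤⟨ m≤m+n _ E ⟩
          κ k * (A + E) + E    ∎
          where open ≤-Reasoning

      extreme-far : ∀ k {p q L} → p ≢ q → ¬ Adj p q → Walk (S k) (replicate k p) (replicate k q) L →
                    κ k + κ k ≤ L
      extreme-far zero    _   _    _ = z≤n
      extreme-far (suc k) {p} {q} p≢q ¬pq w with toCopyWalk w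
      ... | stay _ = ⊥-elim (p≢q refl)
      ... | hop {c = c} w' pc rest =
        far (κ k) (dist₂ q p) (dist₂ q c) _ _ (extreme-apart k (adjacent-distinct pc) w') (dist₂-far p≢q ¬pq)
          (dist₂-positive λ { refl → ¬pq pc }) (copyWalk-to-extreme k rest pc)
        where
        far : ∀ K A C l L → K ≤ l → A ≡ 2 → 1 ≤ C → K * (A + C) + C ≤ L →
              (K + suc K) + (K + suc K) ≤ l + suc L
        far K _ C l L K≤l refl 1≤C bound = begin
          (K + suc K) + (K + suc K) ≡⟨ regroup K ⟩
          K + suc (K * 3 + 1)       ≤⟨ +-mono-≤ K≤l (s≤s (≤-trans 3K+1≤ bound)) ⟩
          l + suc L                 ∎
          where
          open ≤-Reasoning
          3K+1≤ : K * 3 + 1 ≤ K * (2 + C) + C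
          3K+1≤ = +-mono-≤ (*-monoʳ-≤ K (+-monoʳ-≤ 2 1≤C)) 1≤C
          regroup : ∀ K → (K + suc K) + (K + suc K) ≡ K + suc (K * 3 + 1)
          regroup = solve-∀

    -- An excursion c → c₁ → e ≠ c → ⋯ → f → c is replaced by the walk c₁^k → c^k → f^k
    -- inside copy c, of length 2 κ k, which is no longer than the crossing of copy c₁
    -- from c^k to e^k (c, e are distinct and, as G has no triangle c c₁ e, non-adjacent).
    mutual
      within-copy : ∀ {k c u v L} → CopyWalk {k} c u c v L → Σ ℕ λ L' → L' ≤ L × Walk (S k) u v L'
      within-copy (stay w) = _ , ≤-refl , w
      within-copy (hop w cc₁ (stay _)) = ⊥-elim (irrefl cc₁)
      within-copy {k} {c} (hop {c = c₁} {l = l} w cc₁ (hop {c = e} {l = l'} {L = L} w' c₁e rest)) with e ≟ c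
      ... | yes refl with within-copy rest
      ... | L' , L'≤L , w'' =
        l + L' , +-monoʳ-≤ l (≤-trans L'≤L (≤-trans (n≤1+n L) (≤-trans (m≤n+m (suc L) l') (n≤1+n _)))) , w ++ʷ w''
      within-copy {k} {c} (hop {c = c₁} {l = l} w cc₁ (hop {c = e} {l = l'} {L = L} w' c₁e rest)) | no e≢c
        with last-entry rest e≢c
      ... | f , fc , ℓ , ℓ<L , w'' =
        l + ((κ k + κ k) + ℓ) ,
        +-monoʳ-≤ l (≤-trans (+-mono-≤ crossing (≤-trans (n≤1+n ℓ) (≤-trans ℓ<L (n≤1+n L)))) (n≤1+n _)) ,
        w ++ʷ (extremeWalk₂ k (adj-sym cc₁) (adj-sym fc) ++ʷ w'')
        where
        crossing : κ k + κ k ≤ l'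
        crossing = extreme-far k (λ c≡e → e≢c (sym c≡e)) (λ ce → triangle-free c c₁ e (cc₁ , c₁e , ce)) w'

      last-entry : ∀ {k e p c v L} → CopyWalk {k} e (replicate k p) c v L → e ≢ c →
                   Σ V λ f → Adj f c × Σ ℕ λ ℓ → suc ℓ ≤ L × Walk (S k) (replicate k f) v ℓ
      last-entry (stay _) e≢c = ⊥-elim (e≢c refl)
      last-entry {e = e} {c = c} (hop {c = g} {l = l} {L = L} w eg rest) e≢c with g ≟ c
      ... | yes refl with within-copy rest
      ... | ℓ , ℓ≤L , w' = e , eg , ℓ , ≤-trans (s≤s ℓ≤L) (m≤n+m (suc L) l) , w'
      last-entry {e = e} {c = c} (hop {c = g} {l = l} {L = L} w eg rest) e≢c | no g≢c with last-entry rest g≢c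
      ... | f , fc , ℓ , ℓ<L , w' = f , fc , ℓ , ≤-trans ℓ<L (≤-trans (n≤1+n L) (m≤n+m (suc L) l)) , w'

    dist-drop-letter : ∀ {k c u v D} → Dist (S (suc k)) (c ∷ u) (c ∷ v) D → Dist (S k) u v D
    dist-drop-letter {c = c} (w , minimal) with within-copy (toCopyWalk w)
    ... | L' , L'≤D , w' with ≤-antisym L'≤D (minimal L' (liftʷ c w'))
    ... | refl = w' , λ k w'' → minimal k (liftʷ c w'')

    dist-drop-prefix : ∀ r {k z} {u v : Vec V k} {D} →
                       Dist (S (r + k)) (replicate r z ++ u) (replicate r z ++ v) D → Dist (S k) u v D
    dist-drop-prefix zero    dist = dist
    dist-drop-prefix (suc r) dist = dist-drop-prefix r (dist-drop-letter dist)

    -- A non-backtracking copy walk from c p^k (p ~ c) to y ys has a tail that is no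
    -- longer: each intermediate copy c is entered from p and left towards g ≠ p, and
    -- since G has no triangle p c g, crossing it costs at least 2 κ k.
    copyWalk→tail : ∀ {k p c y ys L} (cw : CopyWalk {k} c (replicate k p) y ys L) → Adj p c →
                    LeavesAvoiding p cw → NonBacktracking cw → Σ (Tail k p c y ys) λ T → tailLength T ≤ L
    copyWalk→tail {L = L} (stay w) _ _ _ = tail 0 nil L w , ≤-reflexive (+-identityʳ L)
    copyWalk→tail {k} {p} {c} (hop {c = g} {l = l} {L = L} w cg rest) pc g≢p (avoids , nb)
      with copyWalk→tail rest cg avoids nb
    ... | tail m trail ℓ leg , bound =
      tail (suc m) (cons cg trail) ℓ leg ,
      (begin
        ℓ + (suc (κ k + κ k) + m * cross k) ≡⟨ tail-hop-length (κ k) ℓ (m * cross k) ⟨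
        (κ k + κ k) + suc (ℓ + m * cross k) ≤⟨ +-mono-≤ crossing (s≤s bound) ⟩
        l + suc L                           ∎)
      where
      open ≤-Reasoning
      crossing : κ k + κ k ≤ l
      crossing = extreme-far k (λ p≡g → g≢p (sym p≡g)) (λ pg → triangle-free p c g (pc , cg , pg)) w

    copyWalk→route : ∀ {k x xs y ys L} (cw : CopyWalk {k} x xs y ys L) → x ≢ y → NonBacktracking cw →
                     Σ (Route k x xs y ys) λ r → routeLength r ≤ L
    copyWalk→route (stay _) x≢y _ = ⊥-elim (x≢y refl)
    copyWalk→route (hop {l = l} leg₁ step rest) _ (avoids , nb) with copyWalk→tail rest step avoids nb
    ... | T , bound = route _ step l leg₁ T , +-monoʳ-≤ l (s≤s bound)

    -- A shortest walk of S(G,k+1) between different copies x ≠ y follows a route of at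
    -- most its length (a backtracking walk would not be shortest).
    shortest-route : ∀ {k x xs y ys D} → x ≢ y → Dist (S (suc k)) (x ∷ xs) (y ∷ ys) D →
                     Σ (Route k x xs y ys) λ r → routeLength r ≤ D
    shortest-route x≢y (w , minimal) with nonBacktracking-or-shorter (toCopyWalk w)
    ... | inj₂ (L' , L'<D , shorter) = ⊥-elim (<⇒≱ L'<D (minimal L' (fromCopyWalk shorter)))
    ... | inj₁ nb = copyWalk→route (toCopyWalk w) x≢y nb

    -- A route making more than d'+1 hops is beaten by a shortest path x a₀ ⋯ y of G:
    -- its end copies are reached from the route's legs by detours of length 2 κ k
    -- each, while the route pays cross k = 2 κ k + 1 for each of its extra copies.
    long-route : ∀ {k x xs y ys d' D} → Dist Adj x y (suc d') → (r : Route k x xs y ys) →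
                 suc (suc d') ≤ Tail.hops (Route.rest r) → routeLength r ≤ D → ¬ ¬ Attained x y xs ys d' D
    long-route {k} {ys = ys} {d'} {D} (cons xa₀ geodesic , minimal)
               (route _ step ℓ₁ leg₁ (tail hops trail ℓ₂ leg₂)) long bound =
      ¬¬-lamElement (vertexAt (cons xa₀ geodesic)) (walkPath xa₀ geodesic minimal (n≤1+n _)) refl
        (extremeWalk₂ k (adj-sym xa₀) step ++ʷ reverseʷ S-sym leg₁)
        (subst (λ r → Walk (S k) (replicate k r) ys _) (sym (vertexAt-penultimate xa₀ geodesic))
          (extremeWalk₂ k (penultimate-step xa₀ geodesic) (adj-sym (penultimate-step step trail)) ++ʷ leg₂))
      >>= λ (v , element , v≤) → pure (inj₁ (+ v , element , +≤+ (value-bound (κ k) v v≤ bound)))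
      where
      open ≤-Reasoning
      value-bound : ∀ K v → v ≤ (K + K + ℓ₁) + (K + K + ℓ₂) → ℓ₁ + suc (ℓ₂ + hops * suc (K + K)) ≤ D →
                    v + suc (d' * suc (K + K)) ≤ D
      value-bound K v v≤ route≤D = begin
        v + suc (d' * suc (K + K))                                   ≤⟨ +-monoˡ-≤ _ v≤ ⟩
        (K + K + ℓ₁) + (K + K + ℓ₂) + suc (d' * suc (K + K))         ≤⟨ m≤m+n _ 2 ⟩
        (K + K + ℓ₁) + (K + K + ℓ₂) + suc (d' * suc (K + K)) + 2     ≡⟨ regroup K d' ℓ₁ ℓ₂ ⟩
        ℓ₁ + suc (ℓ₂ + suc (suc d') * suc (K + K))                   ≤⟨ +-monoʳ-≤ ℓ₁ (s≤s (+-monoʳ-≤ ℓ₂ more-hops)) ⟩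
        ℓ₁ + suc (ℓ₂ + hops * suc (K + K))                           ≤⟨ route≤D ⟩
        D                                                            ∎
        where
        more-hops : suc (suc d') * suc (K + K) ≤ hops * suc (K + K)
        more-hops = *-monoˡ-≤ (suc (K + K)) long
        regroup : ∀ K d' ℓ₁ ℓ₂ → (K + K + ℓ₁) + (K + K + ℓ₂) + suc (d' * suc (K + K)) + 2
                                 ≡ ℓ₁ + suc (ℓ₂ + suc (suc d') * suc (K + K))
        regroup = solve-∀

    -- A route making at most d'+1 hops follows a walk x next ⋯ y of G that is a path of
    -- length d'+1 or d'+2, and its legs bound the λ- resp. λ'-value of that path.
    short-route : ∀ {k x xs y ys d' D} → Dist Adj x y (suc d') → (r : Route k x xs y ys) →
                  Tail.hops (Route.rest r) ≤ suc d' → routeLength r ≤ D → ¬ ¬ Attained x y xs ys d' D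
    short-route {k} {x} {xs} {y} {ys} {d'} {D} (_ , minimal)
                (route _ step ℓ₁ leg₁ (tail hops trail ℓ₂ leg₂)) short bound =
      ¬¬-lamElement (vertexAt (cons step trail)) (walkPath step trail minimal (s≤s short)) refl
        (reverseʷ S-sym leg₁)
        (subst (λ r → Walk (S k) (replicate k r) ys _) (sym (vertexAt-penultimate step trail)) leg₂)
      >>= λ (v , element , v≤) → pure (attained v element v≤)
      where
      value-bound : ∀ {v} → v ≤ ℓ₁ + ℓ₂ → v + suc (hops * cross k) ≤ D
      value-bound {v} v≤ = begin
        v + suc (hops * cross k)          ≤⟨ +-monoˡ-≤ _ v≤ ⟩
        ℓ₁ + ℓ₂ + suc (hops * cross k)    ≡⟨ regroup ℓ₁ ℓ₂ (hops * cross k) ⟩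
        ℓ₁ + suc (ℓ₂ + hops * cross k)    ≤⟨ bound ⟩
        D                                 ∎
        where
        open ≤-Reasoning
        regroup : ∀ ℓ₁ ℓ₂ X → ℓ₁ + ℓ₂ + suc X ≡ ℓ₁ + suc (ℓ₂ + X)
        regroup = solve-∀

      at-length : ∀ v → LamSet G k x y xs ys (suc hops) (+ v) → v ≤ ℓ₁ + ℓ₂ → ∀ {h} → hops ≡ h →
                  Σ ℤ λ v → LamSet G k x y xs ys (suc h) v × v ℤ.+ + suc (h * cross k) ℤ.≤ + D
      at-length v element v≤ refl = + v , element , +≤+ (value-bound v≤)

      -- d' ≤ hops ≤ d' + 1, as the path has length at least d_G(x, y) = d'+1
      attained : ∀ v → LamSet G k x y xs ys (suc hops) (+ v) → v ≤ ℓ₁ + ℓ₂ → Attained x y xs ys d' D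
      attained v element v≤ with hops ℕ.≟ d'
      ... | yes hops≡d' = inj₁ (at-length v element v≤ hops≡d')
      ... | no hops≢d'  = inj₂ (at-length v element v≤ (trans hops≡1+d' (+-comm 1 d')))
        where
        hops≡1+d' : hops ≡ suc d'
        hops≡1+d' = ≤-antisym short
                      (≤∧≢⇒< (≤-pred (minimal _ (cons step trail))) (λ d'≡hops → hops≢d' (sym d'≡hops)))

    lower-bound : ∀ {k x xs y ys d' D} → x ≢ y → Dist Adj x y (suc d') → Dist (S (suc k)) (x ∷ xs) (y ∷ ys) D →
                  ¬ ¬ Attained x y xs ys d' D
    lower-bound {d' = d'} x≢y geodesic dist with shortest-route x≢y dist
    ... | r , bound with Tail.hops (Route.rest r) ≤? suc d'
    ... | yes short = short-route geodesic r short bound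
    ... | no  long  = long-route geodesic r (≰⇒> long) bound

shifted-minimum : ∀ {S S' : ℤ → Set} {μ μ' : ℤ∞} {D α β : ℤ} → IsMin S μ → IsMin S' μ' →
                  (∀ v → S v → D ℤ.≤ v ℤ.+ α) → (∀ v → S' v → D ℤ.≤ v ℤ.+ β) →
                  (Σ ℤ λ v → S v × v ℤ.+ α ℤ.≤ D) ⊎ (Σ ℤ λ v → S' v × v ℤ.+ β ℤ.≤ D) →
                  fin D ≡ min∞ (μ ⊕ α) (μ' ⊕ β)
shifted-minimum {S} {S'} {fin l} {fin l'} {D} {α} {β} (l∈S , l≤) (l'∈S' , l'≤) below below' attained =
  cong fin (ℤ.≤-antisym (ℤ.⊓-glb (below l l∈S) (below' l' l'∈S')) (min≤D attained))
  where
  min≤D : (Σ ℤ λ v → S v × v ℤ.+ α ℤ.≤ D) ⊎ (Σ ℤ λ v → S' v × v ℤ.+ β ℤ.≤ D) →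
          (l ℤ.+ α) ℤ.⊓ (l' ℤ.+ β) ℤ.≤ D
  min≤D (inj₁ (v , v∈S , v+α≤D))  = ℤ.i≤j⇒i⊓k≤j _ (ℤ.≤-trans (ℤ.+-monoˡ-≤ α (l≤ v v∈S)) v+α≤D)
  min≤D (inj₂ (v , v∈S' , v+β≤D)) = ℤ.i≤j⇒k⊓i≤j _ (ℤ.≤-trans (ℤ.+-monoˡ-≤ β (l'≤ v v∈S')) v+β≤D)
shifted-minimum {μ = fin l} {∞} (l∈S , l≤) _ below _ (inj₁ (v , v∈S , v+α≤D)) =
  cong fin (ℤ.≤-antisym (below l l∈S) (ℤ.≤-trans (ℤ.+-monoˡ-≤ _ (l≤ v v∈S)) v+α≤D))
shifted-minimum {μ = fin l} {∞} _ empty' _ _ (inj₂ (v , v∈S' , _)) = ⊥-elim (empty' v v∈S')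
shifted-minimum {μ = ∞} empty _ _ _ (inj₁ (v , v∈S , _)) = ⊥-elim (empty v v∈S)
shifted-minimum {μ = ∞} {fin l'} _ (l'∈S' , l'≤) _ below' (inj₂ (v , v∈S' , v+β≤D)) =
  cong fin (ℤ.≤-antisym (below' l' l'∈S') (ℤ.≤-trans (ℤ.+-monoˡ-≤ _ (l'≤ v v∈S')) v+β≤D))
shifted-minimum {μ = ∞} {∞} _ empty' _ _ (inj₂ (v , v∈S' , _)) = ⊥-elim (empty' v v∈S')

-- Equality on ℤ ∪ {+∞} is decidable, so the theorem may be proved under double negation.
_≟∞_ : (a b : ℤ∞) → Dec (a ≡ b)
fin a ≟∞ fin b with a ℤ.≟ b
... | yes refl = yes refl
... | no a≢b   = no λ { refl → a≢b refl }
fin _ ≟∞ ∞     = no λ ()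
∞     ≟∞ fin _ = no λ ()
∞     ≟∞ ∞     = yes refl

2^≡1+κ : ∀ k → 2 ^ k ≡ suc (κ k)
2^≡1+κ zero    = refl
2^≡1+κ (suc k) = trans (cong (2 *_) (2^≡1+κ k)) (doubling (κ k))
  where
  doubling : ∀ K → 2 * suc K ≡ suc (K + suc K)
  doubling = solve-∀

κ-closed : ∀ k → 2 ^ k ∸ 1 ≡ κ k
κ-closed k = cong (_∸ 1) (2^≡1+κ k)

cross-closed : ∀ k → 2 ^ (k + 1) ∸ 1 ≡ cross k
cross-closed k = begin
  2 ^ (k + 1) ∸ 1    ≡⟨ cong (λ e → 2 ^ e ∸ 1) (+-comm k 1) ⟩
  2 * 2 ^ k ∸ 1      ≡⟨ cong (λ p → 2 * p ∸ 1) (2^≡1+κ k) ⟩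
  2 * suc (κ k) ∸ 1  ≡⟨ cong (_∸ 1) (doubling (κ k)) ⟩
  cross k            ∎
  where
  open ≡-Reasoning
  doubling : ∀ K → 2 * suc K ≡ suc (suc (K + K))
  doubling = solve-∀

α-closed : ∀ s d' → + ((2 ^ (s + 1) ∸ 1) * suc d') - + (2 * (2 ^ s ∸ 1)) ≡ + suc (d' * cross s)
α-closed s d' = begin
  + ((2 ^ (s + 1) ∸ 1) * suc d') - + (2 * (2 ^ s ∸ 1))
    ≡⟨ cong₂ (λ c K → + (c * suc d') - + (2 * K)) (cross-closed s) (κ-closed s) ⟩
  + (cross s * suc d') - + (2 * κ s)
    ≡⟨ cong (λ n → + n - + (2 * κ s)) (split (κ s) d') ⟩
  + (2 * κ s + suc (d' * cross s)) - + (2 * κ s)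
    ≡⟨ ℤ.[+m]-[+n]≡m⊖n _ (2 * κ s) ⟩
  (2 * κ s + suc (d' * cross s)) ℤ.⊖ (2 * κ s)
    ≡⟨ ℤ.⊖-≥ (m≤m+n (2 * κ s) _) ⟩
  + (2 * κ s + suc (d' * cross s) ∸ 2 * κ s)
    ≡⟨ cong +_ (m+n∸m≡n (2 * κ s) _) ⟩
  + suc (d' * cross s) ∎
  where
  open ≡-Reasoning
  split : ∀ K d' → suc (K + K) * suc d' ≡ 2 * K + suc (d' * suc (K + K))
  split = solve-∀

β-closed : ∀ s d' → + ((2 ^ (s + 1) ∸ 1) * suc d' + 1) ≡ + suc ((d' + 1) * cross s)
β-closed s d' = cong +_ (trans (cong (λ c → c * suc d' + 1) (cross-closed s)) (regroup (κ s) d'))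
  where
  regroup : ∀ K d' → suc (K + K) * suc d' + 1 ≡ suc ((d' + 1) * suc (K + K))
  regroup = solve-∀

dist-unsubst : ∀ {G : Graph} {m t} (e : m ≡ t) {u v : Vec (Fin (Graph.n G)) m} {D} →
               Dist (SAdj G t) (subst (Vec (Fin (Graph.n G))) e u) (subst (Vec (Fin (Graph.n G))) e v) D →
               Dist (SAdj G m) u v D
dist-unsubst refl dist = dist

-- Since x ≠ y, d_G(x, y) = d' + 1.  After dropping the common prefix
-- z^(j-1), the upper bound (every λ- and λ'-value) and the lower bound (one of them is
-- attained) pin D down as the minimum of the two shifted sets; the shifts
-- 1 + d' · cross s and 1 + (d'+1) · cross s are the theorem's in closed form.
theorem8 : (G : Graph) → Connected G → NonTrivial G → TriangleFree G →
    (t : ℕ) → 2 ≤ t → (j : ℕ) → (hj₁ : 1 ≤ j) → (hj₂ : j ≤ t ∸ 1) →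
    (x y z : Fin (Graph.n G)) → x ≢ y →
    (xs ys : Vec (Fin (Graph.n G)) (t ∸ j)) →
    (dxy : ℕ) → Dist (Graph.Adj G) x y dxy →
    (λv λ'v : ℤ∞) →
    IsMin (LamSet G (t ∸ j) x y xs ys dxy) λv →
    IsMin (LamSet G (t ∸ j) x y xs ys (dxy + 1)) λ'v →
    (D : ℕ) →
    Dist (SAdj G t)
      (subst (Vec (Fin (Graph.n G))) (lenEq hj₁ (≤-trans hj₂ (m∸n≤m t 1)))
        (replicate (j ∸ 1) z ++ (x ∷ xs)))
      (subst (Vec (Fin (Graph.n G))) (lenEq hj₁ (≤-trans hj₂ (m∸n≤m t 1)))
        (replicate (j ∸ 1) z ++ (y ∷ ys)))
      D →
    fin (+ D) ≡
      min∞ (λv ⊕ ((+ ((2 ^ (t ∸ j + 1) ∸ 1) * dxy)) - (+ (2 * (2 ^ (t ∸ j) ∸ 1)))))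
           (λ'v ⊕ (+ ((2 ^ (t ∸ j + 1) ∸ 1) * dxy + 1)))
theorem8 G _ _ _ t _ j hj₁ hj₂ x y z x≢y xs ys zero (nil , _) _ _ _ _ D _ = ⊥-elim (x≢y refl)
theorem8 G _ _ triangle-free t _ j hj₁ hj₂ x y z x≢y xs ys (suc d') geodesic μ μ' isMin isMin' D dist =
  decidable-stable (fin (+ D) ≟∞ _) do
    dec ← ¬¬-decidable (Graph.Adj G)
    let open Bounds dec triangle-free
        dist' = dist-drop-prefix (j ∸ 1) (dist-unsubst {G = G} (lenEq hj₁ (≤-trans hj₂ (m∸n≤m t 1))) dist)
    attained ← lower-bound x≢y geodesic dist'
    pure (trans (shifted-minimum isMin isMin' (upper-bound dist' d') (upper-bound dist' (d' + 1)) attained)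
                (cong₂ (λ α β → min∞ (μ ⊕ α) (μ' ⊕ β))
                       (sym (α-closed (t ∸ j) d')) (sym (β-closed (t ∸ j) d'))))
  where open Sierpinski G
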